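{- Let $G$ be a connected graph with diameter $2$ and maximum degree $3$. Then $G$ does not admit a barbell partition.
   Context: All graphs are finite and simple. A barbell partition of a graph $G$ is a partition of $V(G)$ into three disjoint sets $\{R,W_1,W_2\}$ such that: $R$ may be empty but $W_1\neq\emptyset$ and $W_2\neq\emptyset$; there are no edges between vertices of $W_1$ and vertices of $W_2$; and for every $v\in R$ and $i\in\{1,2\}$, $|N_G(v)\cap W_i|\neq 1$, where $N_G(v)$ is the set of neighbors of $v$. -}

module Defs where

open import Data.Nat using (ℕ; zero; suc; _≤_; _<_)
open import Data.Fin using (Fin)
open import Data.Bool using (Bool; true; false; T; _∧_)
open import Data.List using (List; length; filterᵇ; allFin)
open import Data.Product using (Σ; ∃; _×_; _,_)
open import Relation.Binary.PropositionalEquality using (_≡_; _≢_)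
open import Relation.Nullary using (¬_)

record Graph (n : ℕ) : Set where
  field
    adj      : Fin n → Fin n → Bool
    symmetric   : ∀ u v → adj u v ≡ adj v u
    irreflexive : ∀ v → adj v v ≡ false

open Graph public

module _ {n : ℕ} (G : Graph n) where

  Adj : Fin n → Fin n → Set
  Adj u v = T (adj G u v)

  card : (Fin n → Bool) → ℕ
  card p = length (filterᵇ p (allFin n))

  degree : Fin n → ℕ
  degree v = card (adj G v)

  MaxDegree : ℕ → Set
  MaxDegree d = (∀ v → degree v ≤ d) × ∃ λ v → degree v ≡ d

  data Walk : Fin n → Fin n → ℕ → Set where
    [] : ∀ {v} → Walk v v zero
    _∷_ : ∀ {u w v k} → Adj u w → Walk w v k → Walk u v (suc k)

  DistLE : Fin n → Fin n → ℕ → Set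
  DistLE u v k = ∃ λ m → m ≤ k × Walk u v m

  Connected : Set
  Connected = ∀ u v → ∃ λ k → Walk u v k

  Diameter : ℕ → Set
  Diameter d = (∀ u v → DistLE u v d)
             × ∃ λ u → ∃ λ v → ∀ m → m < d → ¬ Walk u v m

data Part : Set where
  R W₁ W₂ : Part

isPart : Part → Part → Bool
isPart R  R  = true
isPart W₁ W₁ = true
isPart W₂ W₂ = true
isPart _  _  = false

module _ {n : ℕ} (G : Graph n) where

  nbrsIn : (Fin n → Part) → Fin n → Part → ℕ
  nbrsIn f v P = card G (λ u → adj G v u ∧ isPart (f u) P)

  -- A partition {R, W₁, W₂} of V(G) given by the labelling f
  -- (R = f⁻¹ R, W₁ = f⁻¹ W₁, W₂ = f⁻¹ W₂).
  IsBarbellPartition : (Fin n → Part) → Set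
  IsBarbellPartition f =
      (∃ λ w → f w ≡ W₁)
    × (∃ λ w → f w ≡ W₂)
    × (∀ u v → f u ≡ W₁ → f v ≡ W₂ → ¬ Adj G u v)
    × (∀ v → f v ≡ R → nbrsIn f v W₁ ≢ 1 × nbrsIn f v W₂ ≢ 1)

  AdmitsBarbellPartition : Set
  AdmitsBarbellPartition = ∃ λ f → IsBarbellPartition f

{-# OPTIONS --safe #-}
-- Take w₁ ∈ W₁ and w₂ ∈ W₂. They are distinct and non-adjacent, so diameter 2
-- gives a common neighbour r. It cannot lie in W₁ or W₂ (no W₁–W₂ edges), so
-- r ∈ R; having at least one neighbour in each Wᵢ, the barbell condition forces
-- at least two in each, and then deg r ≥ 4 > 3.
module Submission where

open import Defs
open import Data.Nat using (ℕ; zero; suc; _≤_; _+_; z≤n; s≤s)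
open import Data.Nat.Properties using (≤-trans; m≤n⇒m≤1+n; +-suc; +-mono-≤)
open import Data.Fin using (Fin)
open import Data.Bool using (Bool; true; false; T; _∧_)
open import Data.Bool.Properties using (T?; T-∧)
open import Data.List using (List; []; _∷_; length; filterᵇ; allFin)
open import Data.List.Membership.Propositional using (_∈_)
open import Data.List.Membership.Propositional.Properties using (∈-allFin; ∈-filter⁺)
open import Data.List.Relation.Unary.Any using (here; there)
open import Data.Product using (∃; _×_; _,_)
open import Function using (_∘_; Equivalence)
open import Relation.Binary.PropositionalEquality using (_≡_; _≢_; refl; subst)
open import Relation.Nullary using (¬_)

length-filterᵇ-∧-disjoint :
  ∀ {A : Set} (p b c : A → Bool) → (∀ x → b x ∧ c x ≡ false) → (xs : List A) →
  length (filterᵇ (λ x → p x ∧ b x) xs) + length (filterᵇ (λ x → p x ∧ c x) xs)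
    ≤ length (filterᵇ p xs)
length-filterᵇ-∧-disjoint p b c disjoint [] = z≤n
length-filterᵇ-∧-disjoint p b c disjoint (x ∷ xs)
  with p x | b x | c x | disjoint x | length-filterᵇ-∧-disjoint p b c disjoint xs
... | false | _     | _     | _  | ih = ih
... | true  | true  | true  | () | ih
... | true  | true  | false | _  | ih = s≤s ih
... | true  | false | true  | _  | ih
  rewrite +-suc (length (filterᵇ (λ x → p x ∧ b x) xs)) (length (filterᵇ (λ x → p x ∧ c x) xs))
  = s≤s ih
... | true  | false | false | _  | ih = m≤n⇒m≤1+n ih

∈⇒1≤length : ∀ {A : Set} {x : A} {xs : List A} → x ∈ xs → 1 ≤ length xs
∈⇒1≤length (here _)  = s≤s z≤n
∈⇒1≤length (there _) = s≤s z≤n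

≢1⇒1≤⇒2≤ : ∀ {k} → k ≢ 1 → 1 ≤ k → 2 ≤ k
≢1⇒1≤⇒2≤ {suc zero}    k≢1 _ with () ← k≢1 refl
≢1⇒1≤⇒2≤ {suc (suc k)} _   _ = s≤s (s≤s z≤n)

isPart-W₁∧W₂≡false : ∀ P → isPart P W₁ ∧ isPart P W₂ ≡ false
isPart-W₁∧W₂≡false R  = refl
isPart-W₁∧W₂≡false W₁ = refl
isPart-W₁∧W₂≡false W₂ = refl

isPart-refl : ∀ P → T (isPart P P)
isPart-refl R  = _
isPart-refl W₁ = _
isPart-refl W₂ = _

module _ {n : ℕ} (G : Graph n) where

  Adj-sym : ∀ {u v} → Adj G u v → Adj G v u
  Adj-sym {u} {v} = subst T (symmetric G u v)

  card-pos : ∀ (p : Fin n → Bool) v → T (p v) → 1 ≤ card G p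
  card-pos p v pv = ∈⇒1≤length (∈-filter⁺ (T? ∘ p) (∈-allFin v) pv)

  common-neighbour : ∀ {u v} → DistLE G u v 2 → u ≢ v → ¬ Adj G u v →
                     ∃ λ r → Adj G u r × Adj G r v
  common-neighbour (zero , _ , [])                        u≢v _    with () ← u≢v refl
  common-neighbour (suc zero , _ , u~v ∷ [])              _   ¬u~v with () ← ¬u~v u~v
  common-neighbour (suc (suc zero) , _ , u~r ∷ r~v ∷ [])  _   _    = _ , u~r , r~v
  common-neighbour (suc (suc (suc _)) , s≤s (s≤s ()) , _) _   _

  module _ (f : Fin n → Part) where

    Adj⇒1≤nbrsIn : ∀ {v u P} → Adj G v u → f u ≡ P → 1 ≤ nbrsIn G f v P
    Adj⇒1≤nbrsIn {v} {u} v~u refl =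
      card-pos (λ w → adj G v w ∧ isPart (f w) (f u)) u
               (Equivalence.from T-∧ (v~u , isPart-refl (f u)))

    nbrsIn-W₁+nbrsIn-W₂≤degree : ∀ v → nbrsIn G f v W₁ + nbrsIn G f v W₂ ≤ degree G v
    nbrsIn-W₁+nbrsIn-W₂≤degree v =
      length-filterᵇ-∧-disjoint (adj G v) (λ u → isPart (f u) W₁) (λ u → isPart (f u) W₂)
                                (isPart-W₁∧W₂≡false ∘ f) (allFin n)

    barbell⇒4≤degree : IsBarbellPartition G f → (∀ u v → DistLE G u v 2) →
                       ∃ λ r → 4 ≤ degree G r
    barbell⇒4≤degree ((w₁ , f≡W₁) , (w₂ , f≡W₂) , noEdge , rCondition) dist2 =
      let r , w₁~r , r~w₂ = common-neighbour (dist2 w₁ w₂) w₁≢w₂ (noEdge w₁ w₂ f≡W₁ f≡W₂)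
      in r , middle-in-R r (Adj-sym w₁~r) r~w₂ (f r) refl
      where
        w₁≢w₂ : w₁ ≢ w₂
        w₁≢w₂ refl with () ← subst (_≡ W₂) f≡W₁ f≡W₂

        middle-in-R : ∀ r → Adj G r w₁ → Adj G r w₂ → ∀ P → f r ≡ P → 4 ≤ degree G r
        middle-in-R r _    r~w₂ W₁ fr≡W₁ with () ← noEdge r w₂ fr≡W₁ f≡W₂ r~w₂
        middle-in-R r r~w₁ _    W₂ fr≡W₂ with () ← noEdge w₁ r f≡W₁ fr≡W₂ (Adj-sym r~w₁)
        middle-in-R r r~w₁ r~w₂ R  fr≡R  =
          let ≢1-W₁ , ≢1-W₂ = rCondition r fr≡R
          in ≤-trans (+-mono-≤ (≢1⇒1≤⇒2≤ ≢1-W₁ (Adj⇒1≤nbrsIn r~w₁ f≡W₁))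
                               (≢1⇒1≤⇒2≤ ≢1-W₂ (Adj⇒1≤nbrsIn r~w₂ f≡W₂)))
                     (nbrsIn-W₁+nbrsIn-W₂≤degree r)

mainTheorem3 : ∀ (n : ℕ) (G : Graph n) → Connected G → Diameter G 2
                 → MaxDegree G 3 → ¬ AdmitsBarbellPartition G
mainTheorem3 n G _ (dist2 , _) (degree≤3 , _) (f , barbell)
  with r , 4≤deg ← barbell⇒4≤degree G f barbell dist2
  with s≤s (s≤s (s≤s ())) ← ≤-trans 4≤deg (degree≤3 r)
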